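{- Let $q = p^e$ with $p$ an odd prime and $e\ge 3$, let $r$ be an integer with $0\le r\le e-1$, let $h = (p-1)^{p^r}$, and let $H_{q,r} = \langle [h]\rangle \le \mathbb{Z}_q^*$ (residues modulo $q$). Then: (a) the order of $[p-1]$ in $\mathbb{Z}_q^*$ is $2p^{e-1}$; (b) $|H_{q,r}| = 2p^{e-r-1}$, and $$-H_{q,r} = H_{q,r} = \{[h^i] : 0\le i\le 2p^{e-r-1}-1\} = \{[p^{r+1}k\pm 1] : 0\le k\le p^{e-r-1}-1\}.$$
   Context: $\mathbb{Z}_q^*$ is the multiplicative group of units of $\mathbb{Z}_q$; $-H_{q,r} = \{[-x] : [x]\in H_{q,r}\}$. -}

module Defs where

open import Data.Nat using (ℕ; zero; suc; _+_; _*_; _∸_; _^_; _<_; _≤_; NonZero; _%_)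
open import Data.Nat.DivMod using (m%n<n)
open import Data.Fin using (Fin; toℕ; fromℕ<; _≟_)
open import Data.Fin.Subset using (Subset; inside; outside)
open import Data.Vec using (tabulate)
open import Data.List using (upTo)
open import Data.List.Relation.Unary.Any using (any?)
open import Data.Product using (_×_)
open import Data.Bool using (if_then_else_)
open import Relation.Nullary using (does)
open import Relation.Binary.PropositionalEquality using (_≡_)

module _ (q : ℕ) .{{_ : NonZero q}} where

  -- the residue class [x] ∈ ℤ_q, represented by its least nonnegative representative
  res : ℕ → Fin q
  res x = fromℕ< (m%n<n x q)

  neg : Fin q → Fin q
  neg x = res (q ∸ toℕ x)

  IsMulOrder : ℕ → ℕ → Set
  IsMulOrder a n =
    (0 < n) × (res (a ^ n) ≡ res 1) × (∀ m → 0 < m → res (a ^ m) ≡ res 1 → n ≤ m)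

  -- The sequence [g^i] takes at most q values, so every value already occurs
  -- for some i < q; hence the membership test below ranges over i < q.
  cyc : ℕ → Subset q
  cyc g = tabulate (λ x → if does (any? (λ i → res (g ^ i) ≟ x) (upTo q)) then inside else outside)

module Submission where

-- Write u = p − 1 = −v with v = 1 − p. For odd p the binomial theorem gives
-- v^(p^j) = 1 + p^(j+1) c with p ∤ c, so v has order p^(e−1) modulo p^e and,
-- since the sign (−1)^n only matters modulo p, u has order 2p^(e−1): this is (a).
-- Hence h = u^(p^r) has order 2Q with Q = p^(e−r−1), and h ≡ −1 (mod M) with
-- M = p^(r+1), so every power of h is ≡ ±1 (mod M). Among the residues modulo
-- q = QM there are exactly 2Q such classes, and h⁰, …, h^(2Q−1) are pairwise
-- distinct; therefore ⟨h⟩ is exactly the set of residues ≡ ±1 (mod M), and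
-- every claim of (b) is read off from this description.

open import Data.Nat.Base using (ℕ; _≤_)
open import Data.Nat.Primality using (Prime)
open import Relation.Binary.PropositionalEquality using (_≢_)

module IntegerCongruence where

  open import Defs using (res)
  open import Data.Nat.Base as ℕ using (zero; suc; NonZero; _%_; _/_)
  open import Data.Nat.DivMod using (m≡m%n+[m/n]*n; [m+kn]%n≡m%n; m%n<n; m<n⇒m%n≡m)
  open import Data.Nat.Divisibility as ℕ using (divides)
  open import Data.Nat.Primality using (euclidsLemma)
  open import Data.Integer.Base using (ℤ; +_; -[1+_]; -_; 0ℤ; 1ℤ; -1ℤ; _+_; _*_; _^_; ∣_∣)
  import Data.Integer.Properties as ℤ
  open import Data.Integer.Divisibility.Signed as ℤ using (∣ᵤ⇒∣)
  open import Data.Integer.Tactic.RingSolver using (solve-∀)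
  open import Data.Fin.Base using (toℕ)
  open import Data.Fin.Properties using (toℕ-fromℕ<; toℕ-injective; toℕ<n)
  open import Data.Product using (_,_)
  open import Data.Sum using (_⊎_; map; swap)
  open import Function.Base using (_∘_)
  open import Relation.Binary.PropositionalEquality

  infix 4 _≡_[mod_]
  record _≡_[mod_] (a b : ℤ) (n : ℕ) : Set where
    constructor _,_
    field
      quotient : ℤ
      equation : a ≡ b + quotient * + n

  module _ {n : ℕ} where

    mod-refl : ∀ a → a ≡ a [mod n ]
    mod-refl a = 0ℤ , identity a (+ n)
      where identity : ∀ a n → a ≡ a + 0ℤ * n
            identity = solve-∀

    mod-reflexive : ∀ {a b} → a ≡ b → a ≡ b [mod n ]
    mod-reflexive {a} refl = mod-refl a

    mod-sym : ∀ {a b} → a ≡ b [mod n ] → b ≡ a [mod n ]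
    mod-sym {b = b} (k , refl) = - k , identity b k (+ n)
      where identity : ∀ b k n → b ≡ (b + k * n) + (- k) * n
            identity = solve-∀

    mod-trans : ∀ {a b c} → a ≡ b [mod n ] → b ≡ c [mod n ] → a ≡ c [mod n ]
    mod-trans {c = c} (k , refl) (l , refl) = l + k , identity c k l (+ n)
      where identity : ∀ c k l n → (c + l * n) + k * n ≡ c + (l + k) * n
            identity = solve-∀

    mod-+ : ∀ {a b c d} → a ≡ b [mod n ] → c ≡ d [mod n ] → a + c ≡ b + d [mod n ]
    mod-+ {b = b} {d = d} (k , refl) (l , refl) = k + l , identity b d k l (+ n)
      where identity : ∀ b d k l n → (b + k * n) + (d + l * n) ≡ (b + d) + (k + l) * n
            identity = solve-∀

    mod-* : ∀ {a b c d} → a ≡ b [mod n ] → c ≡ d [mod n ] → a * c ≡ b * d [mod n ]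
    mod-* {b = b} {d = d} (k , refl) (l , refl) = k * d + b * l + k * l * + n , identity b d k l (+ n)
      where identity : ∀ b d k l n → (b + k * n) * (d + l * n) ≡ b * d + (k * d + b * l + k * l * n) * n
            identity = solve-∀

    mod-^ : ∀ {a b} m → a ≡ b [mod n ] → a ^ m ≡ b ^ m [mod n ]
    mod-^ zero    _   = mod-refl 1ℤ
    mod-^ (suc m) a≡b = mod-* a≡b (mod-^ m a≡b)

    mod-neg : ∀ {a b} → a ≡ b [mod n ] → - a ≡ - b [mod n ]
    mod-neg {b = b} (k , refl) = - k , identity b k (+ n)
      where identity : ∀ b k n → - (b + k * n) ≡ - b + (- k) * n
            identity = solve-∀

    mod-+-multiple : ∀ a w → a + + n * w ≡ a [mod n ]
    mod-+-multiple a w = w , cong (λ z → a + z) (ℤ.*-comm (+ n) w)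

    mod-+-cancelˡ : ∀ a {b c} → a + b ≡ a + c [mod n ] → b ≡ c [mod n ]
    mod-+-cancelˡ a {b} {c} a+b≡a+c =
      mod-trans (mod-reflexive (cancel a b))
        (mod-trans (mod-+ (mod-refl (- a)) a+b≡a+c) (mod-reflexive (sym (cancel a c))))
      where cancel : ∀ a b → b ≡ - a + (a + b)
            cancel = solve-∀

  mod-∣ : ∀ {d n a b} → d ℕ.∣ n → a ≡ b [mod n ] → a ≡ b [mod d ]
  mod-∣ {d} {b = b} (divides m refl) (k , refl) =
    k * + m , cong (λ z → b + z) (trans (cong (k *_) (ℤ.pos-* m d)) (sym (ℤ.*-assoc k (+ m) (+ d))))

  mod-*-scale : ∀ m {n a b} → a ≡ b [mod n ] → + m * a ≡ + m * b [mod m ℕ.* n ]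
  mod-*-scale m {n} {b = b} (k , refl) =
    k , trans (distribute (+ m) b k (+ n)) (cong (λ z → + m * b + k * z) (sym (ℤ.pos-* m n)))
    where distribute : ∀ m b k n → m * (b + k * n) ≡ m * b + k * (m * n)
          distribute = solve-∀

  mod-*-cancelˡ : ∀ m {n a} .{{_ : NonZero m}} → + m * a ≡ 0ℤ [mod m ℕ.* n ] → a ≡ 0ℤ [mod n ]
  mod-*-cancelˡ m {n} {a} (k , eq) = k , trans (ℤ.*-cancelˡ-≡ (+ m) a (k * + n) (begin
    + m * a              ≡⟨ eq ⟩
    0ℤ + k * + (m ℕ.* n) ≡⟨ cong (λ z → 0ℤ + k * z) (ℤ.pos-* m n) ⟩
    0ℤ + k * (+ m * + n) ≡⟨ rearrange k (+ m) (+ n) ⟩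
    + m * (k * + n)      ∎)) (sym (ℤ.+-identityˡ _))
    where open ≡-Reasoning
          rearrange : ∀ k m n → 0ℤ + k * (m * n) ≡ m * (k * n)
          rearrange = solve-∀

  mod-0⇒∣ : ∀ {n a} → a ≡ 0ℤ [mod n ] → n ℕ.∣ ∣ a ∣
  mod-0⇒∣ {n} (k , refl) = divides ∣ k ∣ (trans (cong ∣_∣ (ℤ.+-identityˡ (k * + n))) (ℤ.abs-* k (+ n)))

  ∣⇒mod-0 : ∀ {n a} → n ℕ.∣ ∣ a ∣ → a ≡ 0ℤ [mod n ]
  ∣⇒mod-0 n∣a with ∣ᵤ⇒∣ n∣a
  ... | ℤ.divides k eq = k , trans eq (sym (ℤ.+-identityˡ _))

  mod-prime-euclid : ∀ {p} → Prime p → ∀ a b → a * b ≡ 0ℤ [mod p ] → a ≡ 0ℤ [mod p ] ⊎ b ≡ 0ℤ [mod p ]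
  mod-prime-euclid p-prime a b ab≡0 = map ∣⇒mod-0 ∣⇒mod-0
    (euclidsLemma ∣ a ∣ ∣ b ∣ p-prime (ℕ.∣-trans (mod-0⇒∣ ab≡0) (ℕ.∣-reflexive (ℤ.abs-* a b))))

  %-mod : ∀ a n .{{_ : NonZero n}} → + a ≡ + (a % n) [mod n ]
  %-mod a n = + (a / n) , (begin
    + a                         ≡⟨ cong +_ (m≡m%n+[m/n]*n a n) ⟩
    + (a % n ℕ.+ a / n ℕ.* n)   ≡⟨ ℤ.pos-+ (a % n) _ ⟩
    + (a % n) + + (a / n ℕ.* n) ≡⟨ cong (λ z → + (a % n) + z) (ℤ.pos-* (a / n) n) ⟩
    + (a % n) + + (a / n) * + n ∎)
    where open ≡-Reasoning

  private
    +-multiple⇒%≡ : ∀ {a b k n} .{{_ : NonZero n}} → + a ≡ + b + + k * + n → a % n ≡ b % n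
    +-multiple⇒%≡ {a} {b} {k} {n} eq = trans (cong (_% n) (ℤ.+-injective (begin
      + a               ≡⟨ eq ⟩
      + b + + k * + n   ≡⟨ cong (λ z → + b + z) (ℤ.pos-* k n) ⟨
      + b + + (k ℕ.* n) ≡⟨ ℤ.pos-+ b (k ℕ.* n) ⟨
      + (b ℕ.+ k ℕ.* n) ∎))) ([m+kn]%n≡m%n b k n)
      where open ≡-Reasoning

  mod⇒%≡ : ∀ {a b n} .{{_ : NonZero n}} → + a ≡ + b [mod n ] → a % n ≡ b % n
  mod⇒%≡ (+ k , eq) = +-multiple⇒%≡ {k = k} eq
  mod⇒%≡ {a} {b} {n} (-[1+ k ] , eq) = sym (+-multiple⇒%≡ {k = suc k}
    (trans (identity (+ b) (+ suc k) (+ n)) (cong (λ z → z + + suc k * + n) (sym eq))))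
    where identity : ∀ b k n → b ≡ (b + (- k) * n) + k * n
          identity = solve-∀

  %≡⇒mod : ∀ {a b n} .{{_ : NonZero n}} → a % n ≡ b % n → + a ≡ + b [mod n ]
  %≡⇒mod {a} {b} {n} eq = mod-trans (%-mod a n) (mod-trans (mod-reflexive (cong +_ eq)) (mod-sym (%-mod b n)))

  module _ {q : ℕ} .{{_ : NonZero q}} where

    toℕ-res : ∀ a → toℕ (res q a) ≡ a % q
    toℕ-res a = toℕ-fromℕ< (m%n<n a q)

    res-toℕ : ∀ x → res q (toℕ x) ≡ x
    res-toℕ x = toℕ-injective (trans (toℕ-res (toℕ x)) (m<n⇒m%n≡m (toℕ<n x)))

    res≡⇒mod : ∀ {a b} → res q a ≡ res q b → + a ≡ + b [mod q ]
    res≡⇒mod {a} {b} eq = %≡⇒mod (trans (sym (toℕ-res a)) (trans (cong toℕ eq) (toℕ-res b)))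

    mod⇒res≡ : ∀ {a b} → + a ≡ + b [mod q ] → res q a ≡ res q b
    mod⇒res≡ {a} {b} a≡b = toℕ-injective (trans (toℕ-res a) (trans (mod⇒%≡ a≡b) (sym (toℕ-res b))))

    res≡⇒toℕ-mod : ∀ {a x} → res q a ≡ x → + toℕ x ≡ + a [mod q ]
    res≡⇒toℕ-mod {a} {x} a≡x = res≡⇒mod (trans (res-toℕ x) (sym a≡x))

  infix 4 _≡±1[mod_]
  _≡±1[mod_] : ℤ → ℕ → Set
  z ≡±1[mod M ] = z ≡ 1ℤ [mod M ] ⊎ z ≡ -1ℤ [mod M ]

  ≡±1-resp : ∀ {M a b} → a ≡ b [mod M ] → b ≡±1[mod M ] → a ≡±1[mod M ]
  ≡±1-resp a≡b = map (mod-trans a≡b) (mod-trans a≡b)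

  ≡±1-neg : ∀ {M a} → a ≡±1[mod M ] → - a ≡±1[mod M ]
  ≡±1-neg = swap ∘ map mod-neg mod-neg

module Powers where

  open import Data.Nat.Base as ℕ using (zero; suc)
  import Data.Nat.Properties as ℕ
  open import Data.Nat.Combinatorics using (_C_; nC1≡n; nCk+nC[k+1]≡[n+1]C[k+1])
  open import Data.Nat.Divisibility as ℕ using (divides; _∣_)
  open import Data.Nat.Primality using (euclidsLemma; prime⇒nonZero)
  import Data.Nat.Tactic.RingSolver as ℕ-Solver
  open import Data.Integer.Base using (ℤ; +_; 0ℤ; 1ℤ; -1ℤ; _+_; _*_; _-_; _^_)
  import Data.Integer.Properties as ℤ
  open import Data.Integer.Tactic.RingSolver using (solve-∀)
  open import Data.Product using (∃; _,_)
  open import Data.Sum using (_⊎_; inj₁; inj₂)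
  open import Data.Empty using (⊥-elim)
  open import Relation.Nullary using (¬_)
  open import Relation.Binary.PropositionalEquality

  pos-^ : ∀ a m → + (a ℕ.^ m) ≡ (+ a) ^ m
  pos-^ a zero    = refl
  pos-^ a (suc m) = trans (ℤ.pos-* a (a ℕ.^ m)) (cong (+ a *_) (pos-^ a m))

  pos-∸ : ∀ {m n} → n ≤ m → + (m ℕ.∸ n) ≡ + m - + n
  pos-∸ {m} {n} n≤m = sym (trans (ℤ.m-n≡m⊖n m n) (ℤ.⊖-≥ n≤m))

  ^-distribʳ-* : ∀ a b m → (a * b) ^ m ≡ a ^ m * b ^ m
  ^-distribʳ-* a b zero    = refl
  ^-distribʳ-* a b (suc m) = trans (cong ((a * b) *_) (^-distribʳ-* a b m)) (interchange a b (a ^ m) (b ^ m))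
    where interchange : ∀ a b x y → (a * b) * (x * y) ≡ (a * x) * (b * y)
          interchange = solve-∀

  even⊎odd : ∀ n → ∃ λ k → n ≡ 2 ℕ.* k ⊎ n ≡ suc (2 ℕ.* k)
  even⊎odd zero = 0 , inj₁ refl
  even⊎odd (suc n) with even⊎odd n
  ... | k , inj₁ refl = k , inj₂ refl
  ... | k , inj₂ refl = suc k , inj₁ (cong suc (sym (ℕ.+-suc k (k ℕ.+ 0))))

  -1^even : ∀ k → -1ℤ ^ (2 ℕ.* k) ≡ 1ℤ
  -1^even k = trans (sym (ℤ.^-*-assoc -1ℤ 2 k)) (ℤ.^-zeroˡ k)

  -1^odd : ∀ k → -1ℤ ^ suc (2 ℕ.* k) ≡ -1ℤ
  -1^odd k = cong (-1ℤ *_) (-1^even k)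

  -1^n≡±1 : ∀ n → -1ℤ ^ n ≡ 1ℤ ⊎ -1ℤ ^ n ≡ -1ℤ
  -1^n≡±1 n with even⊎odd n
  ... | k , inj₁ refl = inj₁ (-1^even k)
  ... | k , inj₂ refl = inj₂ (-1^odd k)

  suc-C-2 : ∀ n → suc n C 2 ≡ n ℕ.+ n C 2
  suc-C-2 n = trans (sym (nCk+nC[k+1]≡[n+1]C[k+1] n 1)) (cong (ℕ._+ n C 2) (nC1≡n n))

  odd-C-2 : ∀ k → suc (2 ℕ.* k) C 2 ≡ suc (2 ℕ.* k) ℕ.* k
  odd-C-2 zero    = refl
  odd-C-2 (suc k) = begin
    suc (2 ℕ.* suc k) C 2       ≡⟨ cong (_C 2) (reassociate k) ⟩
    suc (suc n) C 2             ≡⟨ suc-C-2 (suc n) ⟩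
    suc n ℕ.+ suc n C 2         ≡⟨ cong (suc n ℕ.+_) (suc-C-2 n) ⟩
    suc n ℕ.+ (n ℕ.+ n C 2)     ≡⟨ cong (λ m → suc n ℕ.+ (n ℕ.+ m)) (odd-C-2 k) ⟩
    suc n ℕ.+ (n ℕ.+ n ℕ.* k)   ≡⟨ collect k ⟩
    suc (2 ℕ.* suc k) ℕ.* suc k ∎
    where open ≡-Reasoning
          n = suc (2 ℕ.* k)
          reassociate : ∀ k → suc (2 ℕ.* suc k) ≡ suc (suc (suc (2 ℕ.* k)))
          reassociate = ℕ-Solver.solve-∀
          collect : ∀ k → suc (suc (2 ℕ.* k)) ℕ.+ (suc (2 ℕ.* k) ℕ.+ suc (2 ℕ.* k) ℕ.* k)
                          ≡ suc (2 ℕ.* suc k) ℕ.* suc k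
          collect = ℕ-Solver.solve-∀

  binomial-cubic : ∀ x t → ∃ λ s → (1ℤ + x) ^ t ≡ 1ℤ + + t * x + + (t C 2) * (x * x) + x * x * x * s
  binomial-cubic x zero    = 0ℤ , identity x
    where identity : ∀ x → 1ℤ ≡ 1ℤ + 0ℤ * x + 0ℤ * (x * x) + x * x * x * 0ℤ
          identity = solve-∀
  binomial-cubic x (suc t) with binomial-cubic x t
  ... | s , expansion = + (t C 2) + s + x * s , (begin
    (1ℤ + x) * (1ℤ + x) ^ t
      ≡⟨ cong ((1ℤ + x) *_) expansion ⟩
    (1ℤ + x) * (1ℤ + + t * x + + (t C 2) * (x * x) + x * x * x * s)
      ≡⟨ multiply-out x (+ t) (+ (t C 2)) s ⟩
    1ℤ + (1ℤ + + t) * x + (+ t + + (t C 2)) * (x * x) + x * x * x * (+ (t C 2) + s + x * s)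
      ≡⟨ cong₂ (λ a b → 1ℤ + a * x + b * (x * x) + x * x * x * (+ (t C 2) + s + x * s))
               (sym (ℤ.pos-+ 1 t)) (trans (sym (ℤ.pos-+ t (t C 2))) (cong +_ (sym (suc-C-2 t)))) ⟩
    1ℤ + + suc t * x + + (suc t C 2) * (x * x) + x * x * x * (+ (t C 2) + s + x * s) ∎)
    where open ≡-Reasoning
          multiply-out : ∀ x t c s → (1ℤ + x) * (1ℤ + t * x + c * (x * x) + x * x * x * s)
                                   ≡ 1ℤ + (1ℤ + t) * x + (t + c) * (x * x) + x * x * x * (c + s + x * s)
          multiply-out = solve-∀

  binomial-quadratic : ∀ x t → ∃ λ s → (1ℤ + x) ^ t ≡ 1ℤ + + t * x + x * x * s
  binomial-quadratic x t with binomial-cubic x t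
  ... | s , expansion = + (t C 2) + x * s , trans expansion (regroup x (+ t) (+ (t C 2)) s)
    where regroup : ∀ x t c s → 1ℤ + t * x + c * (x * x) + x * x * x * s ≡ 1ℤ + t * x + x * x * (c + x * s)
          regroup = solve-∀

  ^-monoʳ-∣ : ∀ m {i k} → i ≤ k → m ℕ.^ i ∣ m ℕ.^ k
  ^-monoʳ-∣ m {i} {k} i≤k = divides (m ℕ.^ (k ℕ.∸ i))
    (trans (cong (m ℕ.^_) (sym (ℕ.m+[n∸m]≡n i≤k)))
           (trans (ℕ.^-distribˡ-+-* m i (k ℕ.∸ i)) (ℕ.*-comm (m ℕ.^ i) _)))

  prime-power-∣-cancel : ∀ {p m a} → Prime p → ¬ p ∣ m → ∀ k → p ℕ.^ k ∣ m ℕ.* a → p ℕ.^ k ∣ a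
  prime-power-∣-cancel _ _ zero _ = ℕ.1∣ _
  prime-power-∣-cancel {p} {m} {a} p-prime p∤m (suc k) pᵏ⁺¹∣ma
    with euclidsLemma m a p-prime (ℕ.∣-trans (ℕ.m∣m*n (p ℕ.^ k)) pᵏ⁺¹∣ma)
  ... | inj₁ p∣m = ⊥-elim (p∤m p∣m)
  ... | inj₂ (divides b refl) =
    subst (p ℕ.* p ℕ.^ k ∣_) (ℕ.*-comm p b)
      (ℕ.*-monoʳ-∣ p (prime-power-∣-cancel p-prime p∤m k (ℕ.*-cancelˡ-∣ p {{prime⇒nonZero p-prime}}
        (subst (p ℕ.* p ℕ.^ k ∣_) (rearrange m b p) pᵏ⁺¹∣ma))))
    where rearrange : ∀ m b p → m ℕ.* (b ℕ.* p) ≡ p ℕ.* (m ℕ.* b)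
          rearrange = ℕ-Solver.solve-∀

module OddPrime {p : ℕ} (p-prime : Prime p) (p≢2 : p ≢ 2) where

  open IntegerCongruence
  open Powers
  open import Data.Nat.Base as ℕ using (zero; suc; NonZero)
  import Data.Nat.Properties as ℕ
  open import Data.Nat.Combinatorics using (_C_)
  open import Data.Nat.Divisibility as ℕ using (divides; _∣_)
  open import Data.Nat.Primality using (prime⇒irreducible; prime⇒nonZero; irreducible[2]; ¬prime[1])
  import Data.Nat.Tactic.RingSolver as ℕ-Solver
  open import Data.Integer.Base using (ℤ; +_; 0ℤ; 1ℤ; -1ℤ; _+_; _*_; _-_; _^_)
  import Data.Integer.Properties as ℤ
  open import Data.Integer.Tactic.RingSolver using (solve-∀)
  open import Data.Product using (∃; _×_; _,_; proj₁; proj₂)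
  open import Data.Sum using (inj₁; inj₂; [_,_]′)
  open import Data.Empty using (⊥-elim)
  open import Relation.Nullary using (¬_)
  open import Relation.Binary.PropositionalEquality

  instance
    p≢0 : NonZero p
    p≢0 = prime⇒nonZero p-prime

  p-odd : ∃ λ k → p ≡ suc (2 ℕ.* k)
  p-odd with even⊎odd p
  ... | k , inj₂ p≡1+2k = k , p≡1+2k
  ... | k , inj₁ refl with prime⇒irreducible p-prime (divides k (ℕ.*-comm 2 k))
  ... | inj₂ 2≡p = ⊥-elim (p≢2 (sym 2≡p))

  3≤p : 3 ≤ p
  3≤p with p-odd
  ... | zero  , refl = ⊥-elim (¬prime[1] p-prime)
  ... | suc k , refl = ℕ.≤-trans (ℕ.m≤m+n 3 (2 ℕ.* k)) (ℕ.≤-reflexive (regroup k))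
    where regroup : ∀ k → 3 ℕ.+ 2 ℕ.* k ≡ suc (2 ℕ.* suc k)
          regroup = ℕ-Solver.solve-∀

  p∤2 : ¬ p ∣ 2
  p∤2 p∣2 with irreducible[2] p∣2
  ... | inj₁ refl = ¬prime[1] p-prime
  ... | inj₂ p≡2  = p≢2 p≡2

  p∤-1 : ¬ (-1ℤ ≡ 0ℤ [mod p ])
  p∤-1 p∣-1 = ¬prime[1] (subst Prime (ℕ.∣1⇒≡1 (mod-0⇒∣ p∣-1)) p-prime)

  -1^pʳ : ∀ r → -1ℤ ^ (p ℕ.^ r) ≡ -1ℤ
  -1^pʳ zero    = refl
  -1^pʳ (suc r) = trans (sym (ℤ.^-*-assoc -1ℤ p (p ℕ.^ r))) (trans (cong (_^ (p ℕ.^ r)) -1^p) (-1^pʳ r))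
    where -1^p : -1ℤ ^ p ≡ -1ℤ
          -1^p = let k , p≡1+2k = p-odd in trans (cong (-1ℤ ^_) p≡1+2k) (-1^odd k)

  -- This is where p is odd: the term (p choose 2) x² is divisible by p x².
  1+pʲ⁺¹c^p : ∀ j c → ∃ λ w → (1ℤ + + (p ℕ.^ suc j) * c) ^ p ≡ 1ℤ + + (p ℕ.^ suc (suc j)) * (c + + p * w)
  1+pʲ⁺¹c^p j c with p-odd | binomial-cubic (+ (p ℕ.^ suc j) * c) p
  ... | k , p≡1+2k | s , expansion = w , (begin
    (1ℤ + x) ^ p                                     ≡⟨ expansion ⟩
    1ℤ + P * x + + (p C 2) * (x * x) + x * x * x * s ≡⟨ cong (λ b → 1ℤ + P * x + b * (x * x) + x * x * x * s) pC2≡pk ⟩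
    expanded (+ (p ℕ.^ suc j))                       ≡⟨ cong expanded (ℤ.pos-* p (p ℕ.^ j)) ⟩
    expanded (P * Z)                                 ≡⟨ collect P Z c (+ k) s ⟩
    1ℤ + P * (P * Z) * (c + P * w)                   ≡⟨ cong (λ Y → 1ℤ + Y * (c + P * w)) pʲ⁺²≡PPZ ⟨
    1ℤ + + (p ℕ.^ suc (suc j)) * (c + P * w)         ∎)
    where
      open ≡-Reasoning
      P Z x w : ℤ
      P = + p
      Z = + (p ℕ.^ j)
      x = + (p ℕ.^ suc j) * c
      w = + k * Z * c * c + Z * Z * c * c * c * s
      expanded : ℤ → ℤ
      expanded Y = 1ℤ + P * (Y * c) + P * + k * ((Y * c) * (Y * c)) + (Y * c) * (Y * c) * (Y * c) * s
      pC2≡pk : + (p C 2) ≡ P * + k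
      pC2≡pk = trans (cong +_ (trans (cong (_C 2) p≡1+2k) (trans (odd-C-2 k) (cong (ℕ._* k) (sym p≡1+2k)))))
                     (ℤ.pos-* p k)
      pʲ⁺²≡PPZ : + (p ℕ.^ suc (suc j)) ≡ P * (P * Z)
      pʲ⁺²≡PPZ = trans (ℤ.pos-* p _) (cong (P *_) (ℤ.pos-* p _))
      collect : ∀ P Z c k s →
        1ℤ + P * (P * Z * c) + P * k * ((P * Z * c) * (P * Z * c)) + (P * Z * c) * (P * Z * c) * (P * Z * c) * s
          ≡ 1ℤ + P * (P * Z) * (c + P * (k * Z * c * c + Z * Z * c * c * c * s))
      collect = solve-∀

  1+pʲ⁺¹c^t≡1⇒p∣t : ∀ j {c} t → ¬ (c ≡ 0ℤ [mod p ]) →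
                    (1ℤ + + (p ℕ.^ suc j) * c) ^ t ≡ 1ℤ [mod p ℕ.^ suc (suc j) ] → p ∣ t
  1+pʲ⁺¹c^t≡1⇒p∣t j {c} t p∤c power≡1 =
    [ mod-0⇒∣ , (λ p∣c → ⊥-elim (p∤c p∣c)) ]′ (mod-prime-euclid p-prime (+ t) c p∣tc)
    where
      P Y Z s : ℤ
      P = + p
      Y = + (p ℕ.^ suc j)
      Z = + (p ℕ.^ j)
      s = proj₁ (binomial-quadratic (Y * c) t)
      power≡ : (1ℤ + Y * c) ^ t ≡ 1ℤ + Y * (+ t * c + P * (Z * c * c * s))
      power≡ = begin
        (1ℤ + Y * c) ^ t                                 ≡⟨ proj₂ (binomial-quadratic (Y * c) t) ⟩
        1ℤ + + t * (Y * c) + (Y * c) * (Y * c) * s       ≡⟨ cong (λ Y′ → 1ℤ + + t * (Y * c) + (Y * c) * (Y′ * c) * s)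
                                                                  (ℤ.pos-* p (p ℕ.^ j)) ⟩
        1ℤ + + t * (Y * c) + (Y * c) * ((P * Z) * c) * s ≡⟨ collect Y P Z c (+ t) s ⟩
        1ℤ + Y * (+ t * c + P * (Z * c * c * s))         ∎
        where open ≡-Reasoning
              collect : ∀ Y P Z c t s → 1ℤ + t * (Y * c) + (Y * c) * ((P * Z) * c) * s
                                        ≡ 1ℤ + Y * (t * c + P * (Z * c * c * s))
              collect = solve-∀
      higher-terms≡0 : Y * (+ t * c + P * (Z * c * c * s)) ≡ 0ℤ [mod p ℕ.^ suc j ℕ.* p ]
      higher-terms≡0 = subst (λ n → Y * (+ t * c + P * (Z * c * c * s)) ≡ 0ℤ [mod n ]) (ℕ.*-comm p (p ℕ.^ suc j))
                         (mod-+-cancelˡ 1ℤ (mod-trans (mod-reflexive (sym power≡)) power≡1))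
      p∣tc : + t * c ≡ 0ℤ [mod p ]
      p∣tc = mod-trans (mod-sym (mod-+-multiple (+ t * c) (Z * c * c * s)))
               (mod-*-cancelˡ (p ℕ.^ suc j) {{ℕ.m^n≢0 p (suc j)}} higher-terms≡0)

  v : ℤ
  v = 1ℤ - + p

  Expansion : ℕ → Set
  Expansion j = ∃ λ c → v ^ (p ℕ.^ j) ≡ 1ℤ + + (p ℕ.^ suc j) * c × ¬ (c ≡ 0ℤ [mod p ])

  v^pʲ-expansion : ∀ j → Expansion j
  v^pʲ-expansion zero    = -1ℤ , trans (base (+ p)) (cong (λ z → 1ℤ + + z * -1ℤ) (sym (ℕ.*-identityʳ p))) , p∤-1
    where base : ∀ P → (1ℤ - P) * 1ℤ ≡ 1ℤ + P * -1ℤ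
          base = solve-∀
  v^pʲ-expansion (suc j) = lift (v^pʲ-expansion j)
    where
      lift : Expansion j → Expansion (suc j)
      lift (c , v^pʲ≡1+pʲ⁺¹c , p∤c) = c + + p * w , (begin
        v ^ (p ℕ.* p ℕ.^ j)            ≡⟨ cong (v ^_) (ℕ.*-comm p (p ℕ.^ j)) ⟩
        v ^ (p ℕ.^ j ℕ.* p)            ≡⟨ ℤ.^-*-assoc v (p ℕ.^ j) p ⟨
        (v ^ (p ℕ.^ j)) ^ p            ≡⟨ cong (_^ p) v^pʲ≡1+pʲ⁺¹c ⟩
        (1ℤ + + (p ℕ.^ suc j) * c) ^ p ≡⟨ proj₂ (1+pʲ⁺¹c^p j c) ⟩
        1ℤ + + (p ℕ.^ suc (suc j)) * (c + + p * w) ∎) ,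
        λ p∣c+pw → p∤c (mod-trans (mod-sym (mod-+-multiple c w)) p∣c+pw)
        where open ≡-Reasoning
              w : ℤ
              w = proj₁ (1+pʲ⁺¹c^p j c)

  v^pʲ≡1 : ∀ j → v ^ (p ℕ.^ j) ≡ 1ℤ [mod p ℕ.^ suc j ]
  v^pʲ≡1 j = let c , v^pʲ≡1+pʲ⁺¹c , _ = v^pʲ-expansion j in
    c , trans v^pʲ≡1+pʲ⁺¹c (cong (λ z → 1ℤ + z) (ℤ.*-comm (+ (p ℕ.^ suc j)) c))

  v≡1 : v ≡ 1ℤ [mod p ]
  v≡1 = -1ℤ , subtract (+ p)
    where subtract : ∀ P → 1ℤ - P ≡ 1ℤ + -1ℤ * P
          subtract = solve-∀

  v^n≡1⇒pʲ∣n : ∀ j n → v ^ n ≡ 1ℤ [mod p ℕ.^ suc j ] → p ℕ.^ j ∣ n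
  v^n≡1⇒pʲ∣n zero    n _     = ℕ.1∣ n
  v^n≡1⇒pʲ∣n (suc j) n v^n≡1 =
    step (v^n≡1⇒pʲ∣n j n (mod-∣ (^-monoʳ-∣ p (ℕ.n≤1+n (suc j))) v^n≡1)) (v^pʲ-expansion j)
    where
      step : p ℕ.^ j ∣ n → Expansion j → p ℕ.^ suc j ∣ n
      step (divides t refl) (c , v^pʲ≡1+pʲ⁺¹c , p∤c) =
        ℕ.*-monoˡ-∣ (p ℕ.^ j) (1+pʲ⁺¹c^t≡1⇒p∣t j t p∤c (mod-trans (mod-reflexive (sym v^n≡power)) v^n≡1))
        where v^n≡power : v ^ (t ℕ.* p ℕ.^ j) ≡ (1ℤ + + (p ℕ.^ suc j) * c) ^ t
              v^n≡power = trans (cong (v ^_) (ℕ.*-comm t (p ℕ.^ j)))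
                          (trans (sym (ℤ.^-*-assoc v (p ℕ.^ j) t)) (cong (_^ t) v^pʲ≡1+pʲ⁺¹c))

  u : ℤ
  u = + (p ℕ.∸ 1)

  u^n≡±v^n : ∀ n → u ^ n ≡ -1ℤ ^ n * v ^ n
  u^n≡±v^n n = trans (cong (_^ n) u≡-v) (^-distribʳ-* -1ℤ v n)
    where negate : ∀ P → P - 1ℤ ≡ -1ℤ * (1ℤ - P)
          negate = solve-∀
          u≡-v : u ≡ -1ℤ * v
          u≡-v = trans (pos-∸ (ℕ.>-nonZero⁻¹ p)) (negate (+ p))

  -- For odd n, u^n ≡ −v^n ≡ −1 (mod p), which cannot be 1 as p ∤ 2.
  u^n≡1⇒2pʲ∣n : ∀ j n → u ^ n ≡ 1ℤ [mod p ℕ.^ suc j ] → 2 ℕ.* p ℕ.^ j ∣ n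
  u^n≡1⇒2pʲ∣n j n u^n≡1 with even⊎odd n
  ... | a , inj₁ refl =
    ℕ.*-monoʳ-∣ 2 (prime-power-∣-cancel {a = a} p-prime p∤2 j (v^n≡1⇒pʲ∣n j (2 ℕ.* a) v^n≡1))
    where v^n≡1 : v ^ (2 ℕ.* a) ≡ 1ℤ [mod p ℕ.^ suc j ]
          v^n≡1 = mod-trans (mod-reflexive (sym (trans (u^n≡±v^n (2 ℕ.* a))
                    (trans (cong (_* v ^ (2 ℕ.* a)) (-1^even a)) (ℤ.*-identityˡ _))))) u^n≡1
  ... | a , inj₂ refl = ⊥-elim (p∤2 (mod-0⇒∣ (mod-+ -1≡1 (mod-refl -1ℤ))))
    where -1≡1 : -1ℤ ≡ 1ℤ [mod p ]
          -1≡1 = mod-trans (mod-sym (mod-trans (mod-reflexive (u^n≡±v^n n))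
                   (mod-* (mod-reflexive (-1^odd a)) (mod-trans (mod-^ n v≡1) (mod-reflexive (ℤ.^-zeroˡ n))))))
                   (mod-∣ (ℕ.m∣m*n (p ℕ.^ j)) u^n≡1)

  2pʲ∣n⇒u^n≡1 : ∀ j n → 2 ℕ.* p ℕ.^ j ∣ n → u ^ n ≡ 1ℤ [mod p ℕ.^ suc j ]
  2pʲ∣n⇒u^n≡1 j n (divides m refl) = mod-trans (mod-reflexive (u^n≡±v^n n)) (mod-* (mod-reflexive sign≡1) v^n≡1)
    where
      regroup : ∀ m q → m ℕ.* (2 ℕ.* q) ≡ 2 ℕ.* (m ℕ.* q)
      regroup = ℕ-Solver.solve-∀
      regroup′ : ∀ m q → m ℕ.* (2 ℕ.* q) ≡ q ℕ.* (2 ℕ.* m)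
      regroup′ = ℕ-Solver.solve-∀
      sign≡1 : -1ℤ ^ n ≡ 1ℤ
      sign≡1 = trans (cong (-1ℤ ^_) (regroup m (p ℕ.^ j))) (-1^even (m ℕ.* p ℕ.^ j))
      v^n≡[v^pʲ]^2m : v ^ n ≡ (v ^ (p ℕ.^ j)) ^ (2 ℕ.* m)
      v^n≡[v^pʲ]^2m = trans (cong (v ^_) (regroup′ m (p ℕ.^ j))) (sym (ℤ.^-*-assoc v (p ℕ.^ j) (2 ℕ.* m)))
      v^n≡1 : v ^ n ≡ 1ℤ [mod p ℕ.^ suc j ]
      v^n≡1 = mod-trans (mod-reflexive v^n≡[v^pʲ]^2m)
                (mod-trans (mod-^ (2 ℕ.* m) (v^pʲ≡1 j)) (mod-reflexive (ℤ.^-zeroˡ (2 ℕ.* m))))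

  u^pʳ≡-1 : ∀ r → u ^ (p ℕ.^ r) ≡ -1ℤ [mod p ℕ.^ suc r ]
  u^pʳ≡-1 r = mod-trans (mod-reflexive (u^n≡±v^n (p ℕ.^ r))) (mod-* (mod-reflexive (-1^pʳ r)) (v^pʲ≡1 r))

module Counting where

  open import Defs using (res; cyc)
  open import Data.Nat.Base using (zero; suc; NonZero; _+_; _*_; _^_; _<_; s≤s; z≤n; _≡ᵇ_)
  open import Data.Nat.Properties using (n<1+n; <-irrefl; +-assoc)
  open import Data.Bool.Base using (Bool; true; false; if_then_else_; _∨_)
  open import Data.Fin.Base using (Fin; toℕ; punchOut)
  open import Data.Fin.Properties using (_≟_; pigeonhole; punchOut-injective; any?)
  open import Data.Fin.Subset using (Subset; inside; outside; _∈_; ∣_∣)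
  open import Data.Vec.Base using (tabulate)
  open import Data.Vec.Properties using (lookup∘tabulate; []=⇒lookup; lookup⇒[]=; tabulate-cong)
  open import Data.List.Base using (upTo)
  open import Data.List.Relation.Unary.Any using (Any) renaming (any? to anyᴸ?)
  open import Data.List.Membership.Propositional using (find; lose)
  open import Data.List.Membership.Propositional.Properties using (∈-upTo⁺; ∈-upTo⁻)
  open import Data.Product using (∃; _×_; _,_)
  open import Data.Empty using (⊥-elim)
  open import Function.Base using (_∘_)
  open import Function.Bundles using (_⇔_; mk⇔)
  open import Function.Construct.Composition using (_⇔-∘_)
  open import Function.Construct.Symmetry using (⇔-sym)
  open import Function.Definitions using (Injective)
  open import Level using (0ℓ)
  open import Relation.Nullary using (yes; no; does)
  open import Relation.Nullary.Decidable using (does-⇔; dec-true)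
  open import Relation.Unary using (Pred; Decidable)
  open import Relation.Binary.PropositionalEquality

  injective⇒surjective : ∀ {n} (f : Fin n → Fin n) → Injective _≡_ _≡_ f → ∀ y → ∃ λ x → f x ≡ y
  injective⇒surjective {suc n} f f-injective y with any? (λ x → f x ≟ y)
  ... | yes hit = hit
  ... | no miss with pigeonhole (n<1+n n) (λ x → punchOut {i = y} {j = f x} (λ y≡fx → miss (x , sym y≡fx)))
  ... | x , x′ , x<x′ , collision = ⊥-elim (<-irrefl (cong toℕ (f-injective (punchOut-injective
          (λ y≡fx → miss (x , sym y≡fx)) (λ y≡fx′ → miss (x′ , sym y≡fx′)) collision))) x<x′)

  subset : ∀ {n} {P : Pred (Fin n) 0ℓ} → Decidable P → Subset n
  subset P? = tabulate (λ x → if does (P? x) then inside else outside)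

  ∈-subset : ∀ {n} {P : Pred (Fin n) 0ℓ} (P? : Decidable P) x → x ∈ subset P? ⇔ P x
  ∈-subset {P = P} P? x = mk⇔ to from
    where
      to : x ∈ subset P? → P x
      to x∈ with P? x | trans (sym (lookup∘tabulate _ x)) ([]=⇒lookup x∈)
      ... | yes px | _ = px
      from : P x → x ∈ subset P?
      from px = lookup⇒[]= x _
        (trans (lookup∘tabulate _ x) (cong (λ b → if b then inside else outside) (dec-true (P? x) px)))

  subset-cong : ∀ {n} {P Q : Pred (Fin n) 0ℓ} (P? : Decidable P) (Q? : Decidable Q) →
                (∀ x → P x ⇔ Q x) → subset P? ≡ subset Q?
  subset-cong P? Q? P⇔Q =
    tabulate-cong (λ x → cong (λ b → if b then inside else outside) (does-⇔ (P⇔Q x) (P? x) (Q? x)))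

  -- cyc q g is, by definition, the subset decided by this test.
  powers? : ∀ q .{{_ : NonZero q}} g → Decidable (λ x → Any (λ i → res q (g ^ i) ≡ x) (upTo q))
  powers? q g x = anyᴸ? (λ i → res q (g ^ i) ≟ x) (upTo q)

  ∈cyc⇔ : ∀ q .{{_ : NonZero q}} g x → x ∈ cyc q g ⇔ (∃ λ i → i < q × res q (g ^ i) ≡ x)
  ∈cyc⇔ q g x = mk⇔ to from ⇔-∘ ∈-subset (powers? q g) x
    where
      to : Any (λ i → res q (g ^ i) ≡ x) (upTo q) → ∃ λ i → i < q × res q (g ^ i) ≡ x
      to hit with i , i∈ , gⁱ≡x ← find hit = i , ∈-upTo⁻ i∈ , gⁱ≡x
      from : (∃ λ i → i < q × res q (g ^ i) ≡ x) → Any (λ i → res q (g ^ i) ≡ x) (upTo q)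
      from (i , i<q , gⁱ≡x) = lose (∈-upTo⁺ i<q) gⁱ≡x

  count : (ℕ → Bool) → ℕ → ℕ
  count b zero    = 0
  count b (suc n) = (if b 0 then 1 else 0) + count (b ∘ suc) n

  ∣tabulate∣≡count : ∀ n (b : ℕ → Bool) →
                     ∣ tabulate {n = n} (λ x → if b (toℕ x) then inside else outside) ∣ ≡ count b n
  ∣tabulate∣≡count zero    b = refl
  ∣tabulate∣≡count (suc n) b with b 0
  ... | true  = cong suc (∣tabulate∣≡count n (b ∘ suc))
  ... | false = ∣tabulate∣≡count n (b ∘ suc)

  ∣cyc∣≡count : ∀ q .{{_ : NonZero q}} g {P : Pred ℕ 0ℓ} (P? : Decidable P) →
                (∀ x → x ∈ cyc q g ⇔ P (toℕ x)) → ∣ cyc q g ∣ ≡ count (does ∘ P?) q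
  ∣cyc∣≡count q g P? ∈cyc⇔P =
    trans (cong ∣_∣ (subset-cong (powers? q g) (P? ∘ toℕ)
                      (λ x → ∈cyc⇔P x ⇔-∘ ⇔-sym (∈-subset (powers? q g) x))))
          (∣tabulate∣≡count q (does ∘ P?))

  count-+ : ∀ m n b → count b (m + n) ≡ count b m + count (λ x → b (m + x)) n
  count-+ zero    n b = refl
  count-+ (suc m) n b = trans (cong ((if b 0 then 1 else 0) +_) (count-+ m n (b ∘ suc)))
                              (sym (+-assoc (if b 0 then 1 else 0) _ _))

  count-cong : ∀ n {b c} → (∀ {x} → x < n → b x ≡ c x) → count b n ≡ count c n
  count-cong zero    _   = refl
  count-cong (suc n) b≗c =
    cong₂ (λ b₀ m → (if b₀ then 1 else 0) + m) (b≗c (s≤s z≤n)) (count-cong n (b≗c ∘ s≤s))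

  count-periodic : ∀ M b → (∀ x → b (M + x) ≡ b x) → ∀ k → count b (k * M) ≡ k * count b M
  count-periodic M b b-periodic zero    = refl
  count-periodic M b b-periodic (suc k) = trans (count-+ M (k * M) b)
    (cong (count b M +_) (trans (count-cong (k * M) (λ {x} _ → b-periodic x)) (count-periodic M b b-periodic k)))

  count-≡ᵇ : ∀ {a n} → a < n → count (_≡ᵇ a) n ≡ 1
  count-≡ᵇ {zero}  {suc n} _         = cong suc (count-false n)
    where count-false : ∀ n → count (λ _ → false) n ≡ 0
          count-false zero    = refl
          count-false (suc n) = count-false n
  count-≡ᵇ {suc a} {suc n} (s≤s a<n) = count-≡ᵇ a<n

  count-≡ᵇ-pair : ∀ {a b n} → a < b → b < n → count (λ x → (x ≡ᵇ a) ∨ (x ≡ᵇ b)) n ≡ 2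
  count-≡ᵇ-pair {zero}  {suc b} {suc n} _         (s≤s b<n) = cong suc (count-≡ᵇ b<n)
  count-≡ᵇ-pair {suc a} {suc b} {suc n} (s≤s a<b) (s≤s b<n) = count-≡ᵇ-pair a<b b<n

module CyclicSubgroup {p : ℕ} (p-prime : Prime p) (p≢2 : p ≢ 2) (e r : ℕ) (r≤e : r ≤ e) where

  open IntegerCongruence
  open Powers
  open OddPrime p-prime p≢2
  open Counting
  open import Defs using (res; neg; IsMulOrder; cyc)
  open import Data.Nat.Base as ℕ using (suc; NonZero; _%_; _/_)
  import Data.Nat.Properties as ℕ
  open import Data.Nat.DivMod using (m≡m%n+[m/n]*n; m%n<n; m<n⇒m%n≡m; [m+n]%n≡m%n; m<n*o⇒m/o<n; m∣n⇒o%n%m≡o%m)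
  open import Data.Nat.Divisibility as ℕ using (divides; _∣_)
  import Data.Nat.Tactic.RingSolver as ℕ-Solver
  open import Data.Integer.Base using (ℤ; +_; -_; 1ℤ; -1ℤ; _+_; _*_; _-_; _^_)
  import Data.Integer.Properties as ℤ
  open import Data.Integer.Tactic.RingSolver using (solve-∀)
  open import Data.Bool.Base using (Bool; _∨_)
  open import Data.Fin.Base using (Fin; toℕ; fromℕ<)
  open import Data.Fin.Properties using (toℕ-injective; toℕ<n; fromℕ<-injective)
  open import Data.Fin.Subset using (_∈_; ∣_∣)
  open import Data.Product using (∃; _×_; _,_)
  open import Data.Sum using (_⊎_; inj₁; inj₂)
  import Data.Sum as Sum
  open import Data.Empty using (⊥-elim)
  open import Function.Base using (_∘_)
  open import Function.Bundles using (_⇔_; mk⇔; Equivalence)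
  open import Function.Construct.Composition using (_⇔-∘_)
  open import Function.Construct.Symmetry using (⇔-sym)
  open import Relation.Nullary using (Dec; does)
  open import Relation.Nullary.Decidable using (_⊎-dec_)
  open import Relation.Binary.Definitions using (tri<; tri≈; tri>)
  open import Relation.Binary.PropositionalEquality

  q M Q h : ℕ
  q = p ℕ.^ suc e
  M = p ℕ.^ (r ℕ.+ 1)
  Q = p ℕ.^ (suc e ℕ.∸ r ℕ.∸ 1)
  h = (p ℕ.∸ 1) ℕ.^ (p ℕ.^ r)

  instance
    q≢0 : NonZero q
    q≢0 = ℕ.m^n≢0 p (suc e)
    M≢0 : NonZero M
    M≢0 = ℕ.m^n≢0 p (r ℕ.+ 1)
    Q≢0 : NonZero Q
    Q≢0 = ℕ.m^n≢0 p (suc e ℕ.∸ r ℕ.∸ 1)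

  M≡p^[1+r] : M ≡ p ℕ.^ suc r
  M≡p^[1+r] = cong (p ℕ.^_) (ℕ.+-comm r 1)

  pᵉ≡pʳ*Q : p ℕ.^ e ≡ p ℕ.^ r ℕ.* Q
  pᵉ≡pʳ*Q = trans (cong (p ℕ.^_) (sym (ℕ.m+[n∸m]≡n r≤e))) (trans (ℕ.^-distribˡ-+-* p r (e ℕ.∸ r))
              (cong (λ k → p ℕ.^ r ℕ.* p ℕ.^ k) (sym (cong (ℕ._∸ 1) (ℕ.+-∸-assoc 1 r≤e)))))

  2pᵉ≡pʳ*2Q : 2 ℕ.* p ℕ.^ e ≡ p ℕ.^ r ℕ.* (2 ℕ.* Q)
  2pᵉ≡pʳ*2Q = trans (cong (2 ℕ.*_) pᵉ≡pʳ*Q) (rearrange (p ℕ.^ r) Q)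
    where rearrange : ∀ a b → 2 ℕ.* (a ℕ.* b) ≡ a ℕ.* (2 ℕ.* b)
          rearrange = ℕ-Solver.solve-∀

  q≡Q*M : q ≡ Q ℕ.* M
  q≡Q*M = trans (cong (p ℕ.*_) pᵉ≡pʳ*Q) (trans (rearrange p (p ℕ.^ r) Q) (cong (Q ℕ.*_) (sym M≡p^[1+r])))
    where rearrange : ∀ a b c → a ℕ.* (b ℕ.* c) ≡ c ℕ.* (a ℕ.* b)
          rearrange = ℕ-Solver.solve-∀

  M∣q : M ∣ q
  M∣q = divides Q q≡Q*M

  3≤M : 3 ≤ M
  3≤M = ℕ.≤-trans 3≤p
          (ℕ.≤-trans (ℕ.m≤m*n p (p ℕ.^ r) {{ℕ.m^n≢0 p r}}) (ℕ.≤-reflexive (sym M≡p^[1+r])))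

  1<M∸1 : 1 ℕ.< M ℕ.∸ 1
  1<M∸1 = ℕ.∸-monoˡ-< 3≤M (ℕ.s≤s ℕ.z≤n)

  M∸1<M : M ℕ.∸ 1 ℕ.< M
  M∸1<M = ℕ.∸-monoʳ-< {M} {1} {0} (ℕ.s≤s ℕ.z≤n) (ℕ.≤-trans (ℕ.s≤s ℕ.z≤n) 3≤M)

  2Q≤q : 2 ℕ.* Q ≤ q
  2Q≤q = ℕ.≤-trans (ℕ.≤-reflexive (ℕ.*-comm 2 Q))
           (ℕ.≤-trans (ℕ.*-monoʳ-≤ Q (ℕ.≤-trans (ℕ.n≤1+n 2) 3≤M)) (ℕ.≤-reflexive (sym q≡Q*M)))

  order-of-p-1 : IsMulOrder q (p ℕ.∸ 1) (2 ℕ.* p ℕ.^ e)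
  order-of-p-1 = 0<2pᵉ , mod⇒res≡ [p-1]^2pᵉ≡1 , minimal
    where
      0<2pᵉ : 0 ℕ.< 2 ℕ.* p ℕ.^ e
      0<2pᵉ = ℕ.<-≤-trans (ℕ.m^n>0 p e) (ℕ.m≤m+n _ _)
      [p-1]^2pᵉ≡1 : + ((p ℕ.∸ 1) ℕ.^ (2 ℕ.* p ℕ.^ e)) ≡ 1ℤ [mod q ]
      [p-1]^2pᵉ≡1 = mod-trans (mod-reflexive (pos-^ (p ℕ.∸ 1) (2 ℕ.* p ℕ.^ e))) (2pʲ∣n⇒u^n≡1 e _ ℕ.∣-refl)
      minimal : ∀ m → 0 ℕ.< m → res q ((p ℕ.∸ 1) ℕ.^ m) ≡ res q 1 → 2 ℕ.* p ℕ.^ e ≤ m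
      minimal m 0<m [p-1]ᵐ≡1 = ℕ.∣⇒≤ {{ℕ.>-nonZero 0<m}}
        (u^n≡1⇒2pʲ∣n e m (mod-trans (mod-reflexive (sym (pos-^ (p ℕ.∸ 1) m))) (res≡⇒mod [p-1]ᵐ≡1)))

  hⁱ≡u^pʳi : ∀ i → + (h ℕ.^ i) ≡ u ^ (p ℕ.^ r ℕ.* i)
  hⁱ≡u^pʳi i = trans (pos-^ h i) (trans (cong (_^ i) (pos-^ (p ℕ.∸ 1) (p ℕ.^ r))) (ℤ.^-*-assoc u (p ℕ.^ r) i))

  hⁱ≡1⇒2Q∣i : ∀ i → + (h ℕ.^ i) ≡ 1ℤ [mod q ] → 2 ℕ.* Q ∣ i
  hⁱ≡1⇒2Q∣i i hⁱ≡1 = ℕ.*-cancelˡ-∣ (p ℕ.^ r) {{ℕ.m^n≢0 p r}} (subst (_∣ p ℕ.^ r ℕ.* i) 2pᵉ≡pʳ*2Q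
    (u^n≡1⇒2pʲ∣n e (p ℕ.^ r ℕ.* i) (mod-trans (mod-reflexive (sym (hⁱ≡u^pʳi i))) hⁱ≡1)))

  2Q∣i⇒hⁱ≡1 : ∀ i → 2 ℕ.* Q ∣ i → + (h ℕ.^ i) ≡ 1ℤ [mod q ]
  2Q∣i⇒hⁱ≡1 i 2Q∣i = mod-trans (mod-reflexive (hⁱ≡u^pʳi i))
    (2pʲ∣n⇒u^n≡1 e (p ℕ.^ r ℕ.* i)
      (subst (_∣ p ℕ.^ r ℕ.* i) (sym 2pᵉ≡pʳ*2Q) (ℕ.*-monoʳ-∣ (p ℕ.^ r) 2Q∣i)))

  hⁱ≡-1ⁱ : ∀ i → + (h ℕ.^ i) ≡ -1ℤ ^ i [mod M ]
  hⁱ≡-1ⁱ i = mod-trans (mod-reflexive (trans (hⁱ≡u^pʳi i) (sym (ℤ.^-*-assoc u (p ℕ.^ r) i))))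
    (mod-^ i (subst (λ n → u ^ (p ℕ.^ r) ≡ -1ℤ [mod n ]) (sym M≡p^[1+r]) (u^pʳ≡-1 r)))

  hⁱ≡±1 : ∀ i → + (h ℕ.^ i) ≡±1[mod M ]
  hⁱ≡±1 i = Sum.map (mod-trans (hⁱ≡-1ⁱ i) ∘ mod-reflexive) (mod-trans (hⁱ≡-1ⁱ i) ∘ mod-reflexive)
                    (-1^n≡±1 i)

  -- Multiplying by h^(2Q − j) turns h^i ≡ h^j into h^k ≡ 1 with 0 < k < 2Q.
  powers-distinct : ∀ {i j} → i ℕ.< j → j ℕ.< 2 ℕ.* Q → res q (h ℕ.^ i) ≢ res q (h ℕ.^ j)
  powers-distinct {i} {j} i<j j<2Q hⁱ≡hʲ =
    ℕ.<-irrefl refl (ℕ.<-≤-trans k<2Q (ℕ.∣⇒≤ {{ℕ.>-nonZero 0<k}} (hⁱ≡1⇒2Q∣i k hᵏ≡1)))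
    where
      x k : ℕ
      x = 2 ℕ.* Q ℕ.∸ j
      k = i ℕ.+ x
      j+x≡2Q : j ℕ.+ x ≡ 2 ℕ.* Q
      j+x≡2Q = ℕ.m+[n∸m]≡n (ℕ.<⇒≤ j<2Q)
      0<k : 0 ℕ.< k
      0<k = ℕ.<-≤-trans (ℕ.m<n⇒0<n∸m j<2Q) (ℕ.m≤n+m x i)
      k<2Q : k ℕ.< 2 ℕ.* Q
      k<2Q = subst (k ℕ.<_) j+x≡2Q (ℕ.+-monoˡ-< x i<j)
      h^+ : ∀ a b → + (h ℕ.^ (a ℕ.+ b)) ≡ + (h ℕ.^ a) * + (h ℕ.^ b)
      h^+ a b = trans (cong +_ (ℕ.^-distribˡ-+-* h a b)) (ℤ.pos-* (h ℕ.^ a) (h ℕ.^ b))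
      hᵏ≡1 : + (h ℕ.^ k) ≡ 1ℤ [mod q ]
      hᵏ≡1 = mod-trans (mod-reflexive (h^+ i x))
             (mod-trans (mod-* (res≡⇒mod hⁱ≡hʲ) (mod-refl (+ (h ℕ.^ x))))
             (mod-trans (mod-reflexive (sym (h^+ j x)))
             (subst (λ n → + (h ℕ.^ n) ≡ 1ℤ [mod q ]) (sym j+x≡2Q) (2Q∣i⇒hⁱ≡1 (2 ℕ.* Q) ℕ.∣-refl))))

  Residue±1 : ℕ → Set
  Residue±1 a = a % M ≡ 1 ⊎ a % M ≡ M ℕ.∸ 1

  M∸1≡-1 : + (M ℕ.∸ 1) ≡ -1ℤ [mod M ]
  M∸1≡-1 = 1ℤ , trans (pos-∸ (ℕ.>-nonZero⁻¹ M)) (regroup (+ M))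
    where regroup : ∀ m → m - 1ℤ ≡ -1ℤ + 1ℤ * m
          regroup = solve-∀

  ≡±1⇔Residue±1 : ∀ a → + a ≡±1[mod M ] ⇔ Residue±1 a
  ≡±1⇔Residue±1 a = mk⇔
    (Sum.map (λ a≡1 → trans (mod⇒%≡ a≡1) 1%M≡1)
             (λ a≡-1 → trans (mod⇒%≡ (mod-trans a≡-1 (mod-sym M∸1≡-1))) [M∸1]%M≡M∸1))
    (Sum.map (λ a%M≡1 → %≡⇒mod (trans a%M≡1 (sym 1%M≡1)))
             (λ a%M≡M∸1 → mod-trans (%≡⇒mod (trans a%M≡M∸1 (sym [M∸1]%M≡M∸1))) M∸1≡-1))
    where 1%M≡1 : 1 % M ≡ 1
          1%M≡1 = m<n⇒m%n≡m (ℕ.<-trans 1<M∸1 M∸1<M)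
          [M∸1]%M≡M∸1 : (M ℕ.∸ 1) % M ≡ M ℕ.∸ 1
          [M∸1]%M≡M∸1 = m<n⇒m%n≡m M∸1<M

  Residue±1-res : ∀ {a} → Residue±1 a → Residue±1 (toℕ (res q a))
  Residue±1-res {a} ρ rewrite toℕ-res {q} a | m∣n⇒o%n%m≡o%m M q a M∣q = ρ

  hⁱ-Residue±1 : ∀ i → Residue±1 (toℕ (res q (h ℕ.^ i)))
  hⁱ-Residue±1 i = Residue±1-res (Equivalence.to (≡±1⇔Residue±1 _) (hⁱ≡±1 i))

  a<q⇒a/M<Q : ∀ {a} → a ℕ.< q → a / M ℕ.< Q
  a<q⇒a/M<Q {a} a<q = m<n*o⇒m/o<n (subst (a ℕ.<_) q≡Q*M a<q)

  -- A residue ±1 mod M below q = QM is determined by its quotient a / M < Q and its sign.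
  index : ∀ a → Residue±1 a → ℕ
  index a (inj₁ _) = a / M
  index a (inj₂ _) = Q ℕ.+ a / M

  index<2Q : ∀ {a} ρ → a ℕ.< q → index a ρ ℕ.< 2 ℕ.* Q
  index<2Q (inj₁ _) a<q = ℕ.<-≤-trans (a<q⇒a/M<Q a<q) (ℕ.m≤m+n Q _)
  index<2Q (inj₂ _) a<q = ℕ.+-monoʳ-< Q (ℕ.<-≤-trans (a<q⇒a/M<Q a<q) (ℕ.m≤m+n Q 0))

  /-%-injective : ∀ {a b} → a / M ≡ b / M → a % M ≡ b % M → a ≡ b
  /-%-injective {a} {b} a/M≡b/M a%M≡b%M = trans (m≡m%n+[m/n]*n a M)
    (trans (cong₂ (λ x y → x ℕ.+ y ℕ.* M) a%M≡b%M a/M≡b/M) (sym (m≡m%n+[m/n]*n b M)))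

  a/M≢Q+b/M : ∀ {a b} → a ℕ.< q → a / M ≢ Q ℕ.+ b / M
  a/M≢Q+b/M {b = b} a<q eq =
    ℕ.<-irrefl refl (ℕ.<-≤-trans (a<q⇒a/M<Q a<q) (ℕ.≤-trans (ℕ.m≤m+n Q (b / M)) (ℕ.≤-reflexive (sym eq))))

  index-injective : ∀ {a b} ρ σ → a ℕ.< q → b ℕ.< q → index a ρ ≡ index b σ → a ≡ b
  index-injective (inj₁ a%M≡1) (inj₁ b%M≡1) _ _ eq = /-%-injective eq (trans a%M≡1 (sym b%M≡1))
  index-injective (inj₂ a%M≡-1) (inj₂ b%M≡-1) _ _ eq =
    /-%-injective (ℕ.+-cancelˡ-≡ Q _ _ eq) (trans a%M≡-1 (sym b%M≡-1))
  index-injective (inj₁ _) (inj₂ _) a<q _ eq = ⊥-elim (a/M≢Q+b/M a<q eq)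
  index-injective (inj₂ _) (inj₁ _) _ b<q eq = ⊥-elim (a/M≢Q+b/M b<q (sym eq))

  -- i ↦ index of h^i is an injective map Fin 2Q → Fin 2Q, hence onto.
  powers-cover : ∀ {a} → a ℕ.< q → Residue±1 a → ∃ λ i → i ℕ.< 2 ℕ.* Q × res q (h ℕ.^ i) ≡ res q a
  powers-cover {a} a<q ρ =
    let i , fi≡a = injective⇒surjective f f-injective (fromℕ< (index<2Q ρ a<q))
        hⁱ≡a = index-injective (hⁱ-Residue±1 (toℕ i)) ρ (toℕ<n _) a<q (fromℕ<-injective _ _ _ _ fi≡a)
    in toℕ i , toℕ<n i , trans (sym (res-toℕ _)) (cong (res q) hⁱ≡a)
    where
      f : Fin (2 ℕ.* Q) → Fin (2 ℕ.* Q)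
      f i = fromℕ< (index<2Q (hⁱ-Residue±1 (toℕ i)) (toℕ<n (res q (h ℕ.^ toℕ i))))
      f≡⇒hⁱ≡hʲ : ∀ i j → f i ≡ f j → res q (h ℕ.^ toℕ i) ≡ res q (h ℕ.^ toℕ j)
      f≡⇒hⁱ≡hʲ i j fi≡fj = toℕ-injective (index-injective (hⁱ-Residue±1 (toℕ i)) (hⁱ-Residue±1 (toℕ j))
                             (toℕ<n _) (toℕ<n _) (fromℕ<-injective _ _ _ _ fi≡fj))
      f-injective : ∀ {i j} → f i ≡ f j → i ≡ j
      f-injective {i} {j} fi≡fj with ℕ.<-cmp (toℕ i) (toℕ j)
      ... | tri< i<j _ _ = ⊥-elim (powers-distinct i<j (toℕ<n j) (f≡⇒hⁱ≡hʲ i j fi≡fj))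
      ... | tri≈ _ i≡j _ = toℕ-injective i≡j
      ... | tri> _ _ j<i = ⊥-elim (powers-distinct j<i (toℕ<n i) (f≡⇒hⁱ≡hʲ j i (sym fi≡fj)))

  power⇒Residue±1 : ∀ i {x} → res q (h ℕ.^ i) ≡ x → Residue±1 (toℕ x)
  power⇒Residue±1 i hⁱ≡x = subst (Residue±1 ∘ toℕ) hⁱ≡x (hⁱ-Residue±1 i)

  Residue±1⇒power : ∀ x → Residue±1 (toℕ x) → ∃ λ i → i ℕ.< 2 ℕ.* Q × res q (h ℕ.^ i) ≡ x
  Residue±1⇒power x ρ = let i , i<2Q , hⁱ≡x = powers-cover (toℕ<n x) ρ in i , i<2Q , trans hⁱ≡x (res-toℕ x)

  ∈⟨h⟩⇔Residue±1 : ∀ x → x ∈ cyc q h ⇔ Residue±1 (toℕ x)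
  ∈⟨h⟩⇔Residue±1 x = mk⇔ (to ∘ Equivalence.to (∈cyc⇔ q h x)) (Equivalence.from (∈cyc⇔ q h x) ∘ from)
    where
      to : (∃ λ i → i ℕ.< q × res q (h ℕ.^ i) ≡ x) → Residue±1 (toℕ x)
      to (i , _ , hⁱ≡x) = power⇒Residue±1 i hⁱ≡x
      from : Residue±1 (toℕ x) → ∃ λ i → i ℕ.< q × res q (h ℕ.^ i) ≡ x
      from ρ = let i , i<2Q , hⁱ≡x = Residue±1⇒power x ρ in i , ℕ.<-≤-trans i<2Q 2Q≤q , hⁱ≡x

  ∈⟨h⟩⇔power : ∀ x → x ∈ cyc q h ⇔ (∃ λ i → i ℕ.< 2 ℕ.* Q × res q (h ℕ.^ i) ≡ x)
  ∈⟨h⟩⇔power x = mk⇔ (Residue±1⇒power x ∘ Equivalence.to (∈⟨h⟩⇔Residue±1 x))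
                      (λ (i , _ , hⁱ≡x) → Equivalence.from (∈⟨h⟩⇔Residue±1 x) (power⇒Residue±1 i hⁱ≡x))

  neg≡- : ∀ x → + toℕ (neg q x) ≡ - + toℕ x [mod q ]
  neg≡- x = mod-trans (mod-reflexive (cong +_ (toℕ-res (q ℕ.∸ toℕ x))))
              (mod-trans (mod-sym (%-mod (q ℕ.∸ toℕ x) q)) (1ℤ , q∸x≡-x+q))
    where
      regroup : ∀ q x → q - x ≡ - x + 1ℤ * q
      regroup = solve-∀
      q∸x≡-x+q : + (q ℕ.∸ toℕ x) ≡ - + toℕ x + 1ℤ * + q
      q∸x≡-x+q = trans (pos-∸ (ℕ.<⇒≤ (toℕ<n x))) (regroup (+ q) (+ toℕ x))

  neg≡±1⇔≡±1 : ∀ x → + toℕ (neg q x) ≡±1[mod M ] ⇔ + toℕ x ≡±1[mod M ]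
  neg≡±1⇔≡±1 x = mk⇔
    (λ -x≡±1 → subst (_≡±1[mod M ]) (ℤ.neg-involutive _) (≡±1-neg (≡±1-resp (mod-sym neg≡-x) -x≡±1)))
    (λ x≡±1 → ≡±1-resp neg≡-x (≡±1-neg x≡±1))
    where neg≡-x : + toℕ (neg q x) ≡ - + toℕ x [mod M ]
          neg≡-x = mod-∣ M∣q (neg≡- x)

  neg∈⟨h⟩⇔∈⟨h⟩ : ∀ x → neg q x ∈ cyc q h ⇔ x ∈ cyc q h
  neg∈⟨h⟩⇔∈⟨h⟩ x =
    ⇔-sym (∈⟨h⟩⇔Residue±1 x) ⇔-∘ (≡±1⇔Residue±1 (toℕ x) ⇔-∘ (neg≡±1⇔≡±1 x ⇔-∘
      (⇔-sym (≡±1⇔Residue±1 (toℕ (neg q x))) ⇔-∘ ∈⟨h⟩⇔Residue±1 (neg q x))))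

  ±1-test : ℕ → Bool
  ±1-test y = (y ℕ.≡ᵇ 1) ∨ (y ℕ.≡ᵇ M ℕ.∸ 1)

  -- does (Residue±1? a) computes to ±1-test (a % M); the count below relies on this.
  Residue±1? : ∀ a → Dec (Residue±1 a)
  Residue±1? a = (a % M ℕ.≟ 1) ⊎-dec (a % M ℕ.≟ M ℕ.∸ 1)

  ∣⟨h⟩∣≡2Q : ∣ cyc q h ∣ ≡ 2 ℕ.* Q
  ∣⟨h⟩∣≡2Q = begin
    ∣ cyc q h ∣                          ≡⟨ ∣cyc∣≡count q h Residue±1? ∈⟨h⟩⇔Residue±1 ⟩
    count (does ∘ Residue±1?) q          ≡⟨ cong (count (does ∘ Residue±1?)) q≡Q*M ⟩
    count (does ∘ Residue±1?) (Q ℕ.* M)  ≡⟨ count-periodic M _ (λ x → cong ±1-test (M+x%M≡x%M x)) Q ⟩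
    Q ℕ.* count (does ∘ Residue±1?) M    ≡⟨ cong (Q ℕ.*_) one-period ⟩
    Q ℕ.* 2                              ≡⟨ ℕ.*-comm Q 2 ⟩
    2 ℕ.* Q                              ∎
    where
      open ≡-Reasoning
      M+x%M≡x%M : ∀ x → (M ℕ.+ x) % M ≡ x % M
      M+x%M≡x%M x = trans (cong (_% M) (ℕ.+-comm M x)) ([m+n]%n≡m%n x M)
      one-period : count (does ∘ Residue±1?) M ≡ 2
      one-period = trans (count-cong M (λ x<M → cong ±1-test (m<n⇒m%n≡m x<M))) (count-≡ᵇ-pair 1<M∸1 M∸1<M)

  MkPlus1≡1 : ∀ k → + (M ℕ.* k ℕ.+ 1) ≡ 1ℤ [mod M ]
  MkPlus1≡1 k = + k , trans (ℤ.pos-+ (M ℕ.* k) 1) (trans (cong (_+ 1ℤ) (ℤ.pos-* M k)) (regroup (+ M) (+ k)))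
    where regroup : ∀ m k → m * k + 1ℤ ≡ 1ℤ + k * m
          regroup = solve-∀

  q+Mk∸1≡Mk-1 : ∀ k → + (q ℕ.+ M ℕ.* k ℕ.∸ 1) ≡ + M * + k - 1ℤ [mod q ]
  q+Mk∸1≡Mk-1 k = 1ℤ , (begin
    + (q ℕ.+ M ℕ.* k ℕ.∸ 1)   ≡⟨ pos-∸ (ℕ.≤-trans (ℕ.m^n>0 p (suc e)) (ℕ.m≤m+n q (M ℕ.* k))) ⟩
    + (q ℕ.+ M ℕ.* k) - 1ℤ    ≡⟨ cong (_- 1ℤ) (trans (ℤ.pos-+ q (M ℕ.* k)) (cong (λ z → + q + z) (ℤ.pos-* M k))) ⟩
    + q + + M * + k - 1ℤ      ≡⟨ regroup (+ q) (+ M) (+ k) ⟩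
    + M * + k - 1ℤ + 1ℤ * + q ∎)
    where open ≡-Reasoning
          regroup : ∀ q m k → q + m * k - 1ℤ ≡ m * k - 1ℤ + 1ℤ * q
          regroup = solve-∀

  Mk-1≡-1 : ∀ k → + M * + k - 1ℤ ≡ -1ℤ [mod M ]
  Mk-1≡-1 k = + k , regroup (+ M) (+ k)
    where regroup : ∀ m k → m * k - 1ℤ ≡ -1ℤ + k * m
          regroup = solve-∀

  IsMk±1 : Fin q → Set
  IsMk±1 x = ∃ λ k → k ℕ.< Q × (res q (M ℕ.* k ℕ.+ 1) ≡ x ⊎ res q (q ℕ.+ M ℕ.* k ℕ.∸ 1) ≡ x)

  Residue±1⇒IsMk±1 : ∀ x → Residue±1 (toℕ x) → IsMk±1 x
  Residue±1⇒IsMk±1 x (inj₁ a%M≡1) =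
    toℕ x / M , a<q⇒a/M<Q (toℕ<n x) , inj₁ (trans (cong (res q) M[a/M]+1≡a) (res-toℕ x))
    where M[a/M]+1≡a : M ℕ.* (toℕ x / M) ℕ.+ 1 ≡ toℕ x
          M[a/M]+1≡a = trans (ℕ.+-comm _ 1) (trans (cong₂ ℕ._+_ (sym a%M≡1) (ℕ.*-comm M _))
                         (sym (m≡m%n+[m/n]*n (toℕ x) M)))
  Residue±1⇒IsMk±1 x (inj₂ a%M≡M∸1) =
    k , m%n<n (suc (a / M)) Q , inj₂ (trans (mod⇒res≡ q+Mk∸1≡a) (res-toℕ x))
    where
      a k : ℕ
      a = toℕ x
      k = suc (a / M) % Q
      -- k ≡ a/M + 1 (mod Q), so M k ≡ M (a/M + 1) = a + 1 (mod q).
      Mk≡M[a/M+1] : + M * + k ≡ + M * + suc (a / M) [mod q ]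
      Mk≡M[a/M+1] = subst (λ n → + M * + k ≡ + M * + suc (a / M) [mod n ]) (trans (ℕ.*-comm M Q) (sym q≡Q*M))
                      (mod-*-scale M (mod-sym (%-mod (suc (a / M)) Q)))
      M[a/M+1]-1≡a : + M * + suc (a / M) - 1ℤ ≡ + a
      M[a/M+1]-1≡a = begin
        + M * + suc (a / M) - 1ℤ      ≡⟨ regroup (+ M) (+ (a / M)) ⟩
        (+ M - 1ℤ) + + (a / M) * + M  ≡⟨ cong₂ _+_ (sym (pos-∸ (ℕ.>-nonZero⁻¹ M))) (sym (ℤ.pos-* (a / M) M)) ⟩
        + (M ℕ.∸ 1) + + (a / M ℕ.* M) ≡⟨ sym (ℤ.pos-+ (M ℕ.∸ 1) _) ⟩
        + (M ℕ.∸ 1 ℕ.+ a / M ℕ.* M)   ≡⟨ cong (λ b → + (b ℕ.+ a / M ℕ.* M)) (sym a%M≡M∸1) ⟩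
        + (a % M ℕ.+ a / M ℕ.* M)     ≡⟨ cong +_ (sym (m≡m%n+[m/n]*n a M)) ⟩
        + a                           ∎
        where open ≡-Reasoning
              regroup : ∀ m d → m * (1ℤ + d) - 1ℤ ≡ (m - 1ℤ) + d * m
              regroup = solve-∀
      q+Mk∸1≡a : + (q ℕ.+ M ℕ.* k ℕ.∸ 1) ≡ + a [mod q ]
      q+Mk∸1≡a = mod-trans (q+Mk∸1≡Mk-1 k)
                   (mod-trans (mod-+ Mk≡M[a/M+1] (mod-refl -1ℤ)) (mod-reflexive M[a/M+1]-1≡a))

  IsMk±1⇒Residue±1 : ∀ x → IsMk±1 x → Residue±1 (toℕ x)
  IsMk±1⇒Residue±1 x (k , _ , representative) = Equivalence.to (≡±1⇔Residue±1 (toℕ x)) (x≡±1 representative)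
    where
      x≡±1 : res q (M ℕ.* k ℕ.+ 1) ≡ x ⊎ res q (q ℕ.+ M ℕ.* k ℕ.∸ 1) ≡ x → + toℕ x ≡±1[mod M ]
      x≡±1 (inj₁ Mk+1≡x)   = inj₁ (mod-trans (mod-∣ M∣q (res≡⇒toℕ-mod Mk+1≡x)) (MkPlus1≡1 k))
      x≡±1 (inj₂ q+Mk∸1≡x) = inj₂ (mod-trans (mod-∣ M∣q (mod-trans (res≡⇒toℕ-mod q+Mk∸1≡x) (q+Mk∸1≡Mk-1 k)))
                                             (Mk-1≡-1 k))

  ∈⟨h⟩⇔IsMk±1 : ∀ x → x ∈ cyc q h ⇔ IsMk±1 x
  ∈⟨h⟩⇔IsMk±1 x = mk⇔ (Residue±1⇒IsMk±1 x ∘ Equivalence.to (∈⟨h⟩⇔Residue±1 x))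
                        (Equivalence.from (∈⟨h⟩⇔Residue±1 x) ∘ IsMk±1⇒Residue±1 x)

open import Defs
open import Data.Nat using (ℕ; _+_; _*_; _∸_; _^_; _<_; _≤_; NonZero; zero; suc; s≤s)
open import Data.Nat.Primality using (Prime)
open import Data.Fin using (Fin)
open import Data.Fin.Subset using (_∈_; ∣_∣)
open import Data.Product using (_×_; ∃-syntax; _,_)
open import Data.Sum using (_⊎_)
open import Function.Bundles using (_⇔_)
open import Relation.Binary.PropositionalEquality using (_≡_; _≢_)

lemma3p4 : (p e r : ℕ) .{{_ : NonZero (p ^ e)}} → Prime p → p ≢ 2 → 3 ≤ e → r < e →
    IsMulOrder (p ^ e) (p ∸ 1) (2 * p ^ (e ∸ 1))
    × ∣ cyc (p ^ e) ((p ∸ 1) ^ (p ^ r)) ∣ ≡ 2 * p ^ (e ∸ r ∸ 1)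
    × (∀ (x : Fin (p ^ e)) → (neg (p ^ e) x ∈ cyc (p ^ e) ((p ∸ 1) ^ (p ^ r)))
                             ⇔ (x ∈ cyc (p ^ e) ((p ∸ 1) ^ (p ^ r))))
    × (∀ (x : Fin (p ^ e)) → (x ∈ cyc (p ^ e) ((p ∸ 1) ^ (p ^ r)))
                             ⇔ (∃[ i ] (i < 2 * p ^ (e ∸ r ∸ 1)
                                        × res (p ^ e) (((p ∸ 1) ^ (p ^ r)) ^ i) ≡ x)))
    × (∀ (x : Fin (p ^ e)) → (x ∈ cyc (p ^ e) ((p ∸ 1) ^ (p ^ r)))
                             ⇔ (∃[ k ] (k < p ^ (e ∸ r ∸ 1)
                                        × (res (p ^ e) (p ^ (r + 1) * k + 1) ≡ x
                                           ⊎ res (p ^ e) (p ^ e + p ^ (r + 1) * k ∸ 1) ≡ x))))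
lemma3p4 p zero    r _       _   _ ()
lemma3p4 p (suc e) r p-prime p≢2 _ (s≤s r≤e) =
  order-of-p-1 , ∣⟨h⟩∣≡2Q , neg∈⟨h⟩⇔∈⟨h⟩ , ∈⟨h⟩⇔power , ∈⟨h⟩⇔IsMk±1
  where open CyclicSubgroup p-prime p≢2 e r r≤e
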